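{- Let $G=(V,E)$ be a finite, connected, undirected graph (multiple edges allowed, no loops), let $1\le k\le |V|-1$, let $\Pi\in\mathcal{P}_{k+1}$, and let $D_0$ be a $\Pi$-boundary divisor. Then there is no effective divisor $D_1\sim D_0$ whose support intersects every block of $\Pi$.
   Context: Divisors are elements of $\mathbb{Z}^V$; $D\sim D'$ iff $D-D'\in L(\mathbb{Z}^V)$ where $L$ is the Laplacian ($L_{vv}=\deg v$, $L_{uv}=-$number of edges between $u,v$); effective means all entries $\ge0$. $\mathcal{P}_{k+1}$ is the set of partitions of $V$ into $k+1$ nonempty blocks each inducing a connected subgraph. $\deg_{AB}(v)$ is the number of edges incident to $v$ with one endpoint in $A$ and the other in $B$. A generating sequence of $\Pi$ is a sequence of cuts $C_1,\dots,C_k$ (a cut of a connected vertex set being a partition into two nonempty sets each inducing a connected subgraph), $C_i$ splitting into $A_i,B_i$, with $C_1$ a cut of $V$ and $C_i$ ($i\ge2$) a cut of one of $A_{i-1},B_{i-1}$, such that applying them successively yields $\Pi$. A divisor $D$ is $\Pi$-boundary if for some generating sequence and choices $X_i\in\{A_i,B_i\}$, $D_v=\sum_{i=1}^k\deg_{A_iB_i}(v)\chi_{X_i}(v)$ for all $v$. -}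

module Defs where

open import Data.Nat as ℕ using (ℕ; zero; suc; _≤_; _<_)
open import Data.Integer as ℤ using (ℤ; +_; -_)
open import Data.Fin using (Fin; zero; suc; _≟_)
open import Data.Bool using (Bool; true; false; _∨_; _∧_; if_then_else_)
open import Data.Vec using (Vec; []; _∷_)
open import Data.Product using (Σ; ∃; ∃-syntax; _×_; _,_)
open import Data.Sum using (_⊎_)
open import Data.Unit using (⊤)
open import Relation.Binary.PropositionalEquality using (_≡_)
open import Relation.Nullary using (¬_; does)
open import Function.Bundles using (_⇔_)

∑ : ∀ {n} → (Fin n → ℕ) → ℕ
∑ {zero} f = 0
∑ {suc n} f = f zero ℕ.+ ∑ (λ i → f (suc i))

∑ℤ : ∀ {n} → (Fin n → ℤ) → ℤ
∑ℤ {zero} f = + 0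
∑ℤ {suc n} f = f zero ℤ.+ ∑ℤ (λ i → f (suc i))

-- A finite undirected multigraph without loops on vertex set Fin n,
-- given by its (symmetric) edge-multiplicity matrix.
record Graph (n : ℕ) : Set where
  field
    adj    : Fin n → Fin n → ℕ
    sym    : ∀ u v → adj u v ≡ adj v u
    noLoop : ∀ v → adj v v ≡ 0
open Graph public

VSet : ℕ → Set
VSet n = Fin n → Bool

_∈_ : ∀ {n} → Fin n → VSet n → Set
v ∈ S = S v ≡ true

full : ∀ {n} → VSet n
full _ = true

data Reach {n} (G : Graph n) (S : VSet n) : Fin n → Fin n → Set where
  here : ∀ {v} → Reach G S v v
  step : ∀ {u w v} → 0 < adj G u w → w ∈ S → Reach G S w v → Reach G S u v

ConnectedSet : ∀ {n} → Graph n → VSet n → Set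
ConnectedSet G S = (∃[ v ] v ∈ S) × (∀ u v → u ∈ S → v ∈ S → Reach G S u v)

Connected : ∀ {n} → Graph n → Set
Connected G = ConnectedSet G full

deg : ∀ {n} → Graph n → Fin n → ℕ
deg G v = ∑ (λ w → adj G v w)

Laplacian : ∀ {n} → Graph n → Fin n → Fin n → ℤ
Laplacian G u v = if does (u ≟ v) then + deg G u else - (+ adj G u v)

Divisor : ℕ → Set
Divisor n = Fin n → ℤ

applyL : ∀ {n} → Graph n → (Fin n → ℤ) → Divisor n
applyL G f u = ∑ℤ (λ v → Laplacian G u v ℤ.* f v)

_∼⟨_⟩_ : ∀ {n} → Divisor n → Graph n → Divisor n → Set
D ∼⟨ G ⟩ D' = ∃[ f ] (∀ v → D v ℤ.- D' v ≡ applyL G f v)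

Effective : ∀ {n} → Divisor n → Set
Effective D = ∀ v → + 0 ℤ.≤ D v

-- Partitions into k+1 labelled blocks: π v is the block of v.
-- Blocks are nonempty (π surjective) and induce connected subgraphs.
block : ∀ {n m} → (Fin n → Fin m) → Fin m → VSet n
block π j v = does (π v ≟ j)

IsPartition : ∀ {n k} → Graph n → (Fin n → Fin (suc k)) → Set
IsPartition {k = k} G π = ∀ (j : Fin (suc k)) → ConnectedSet G (block π j)

record Cut (n : ℕ) : Set where
  constructor cut
  field
    A B : VSet n
open Cut public

IsCutOf : ∀ {n} → Graph n → VSet n → Cut n → Set
IsCutOf G S c =
  (∀ v → (S v ≡ true) ⇔ ((A c v ∨ B c v) ≡ true)) ×
  (∀ v → (A c v ∧ B c v) ≡ false) ×
  ConnectedSet G (A c) × ConnectedSet G (B c)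

ChainFrom : ∀ {n m} → Graph n → Cut n → Vec (Cut n) m → Set
ChainFrom G prev [] = ⊤
ChainFrom G prev (c ∷ cs) =
  (IsCutOf G (A prev) c ⊎ IsCutOf G (B prev) c) × ChainFrom G c cs

ValidSeq : ∀ {n m} → Graph n → Vec (Cut n) m → Set
ValidSeq G [] = ⊤
ValidSeq G (c ∷ cs) = IsCutOf G full c × ChainFrom G c cs

-- Applying the cuts successively: all vertices start with label 0; applying
-- the i-th cut (i = 1,2,...) gives the vertices of B_i the fresh label i,
-- while those of A_i keep their label.  The resulting partition consists of
-- the label classes.  (labelFrom i cs v: final label when cs are cuts i, i+1, ...)
labelFrom : ∀ {n m} → ℕ → Vec (Cut n) m → ℕ → Fin n → ℕ
labelFrom i [] cur v = cur
labelFrom i (c ∷ cs) cur v =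
  labelFrom (suc i) cs (if B c v then i else cur) v

finalLabel : ∀ {n m} → Vec (Cut n) m → Fin n → ℕ
finalLabel cs v = labelFrom 1 cs 0 v

Yields : ∀ {n m k} → Vec (Cut n) m → (Fin n → Fin (suc k)) → Set
Yields cs π = ∀ u v → (finalLabel cs u ≡ finalLabel cs v) ⇔ (π u ≡ π v)

GeneratingSeq : ∀ {n k} → Graph n → (Fin n → Fin (suc k)) → Vec (Cut n) k → Set
GeneratingSeq G π cs = ValidSeq G cs × Yields cs π

degAB : ∀ {n} → Graph n → Cut n → Fin n → ℕ
degAB G c v =
  if A c v then ∑ (λ w → if B c w then adj G v w else 0)
  else if B c v then ∑ (λ w → if A c w then adj G v w else 0)
  else 0

-- χ_{X_i} with X_i = A_i (choice true) or B_i (choice false).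
χ : ∀ {n} → Cut n → Bool → Fin n → ℕ
χ c true v = if A c v then 1 else 0
χ c false v = if B c v then 1 else 0

boundarySum : ∀ {n m} → Graph n → Vec (Cut n) m → Vec Bool m → Fin n → ℕ
boundarySum G [] [] v = 0
boundarySum G (c ∷ cs) (x ∷ xs) v = degAB G c v ℕ.* χ c x v ℕ.+ boundarySum G cs xs v

IsBoundary : ∀ {n k} → Graph n → (Fin n → Fin (suc k)) → Divisor n → Set
IsBoundary {n} {k} G π D =
  Σ (Vec (Cut n) k) λ cs → GeneratingSeq G π cs ×
  Σ (Vec Bool k) λ xs → ∀ v → D v ≡ + boundarySum G cs xs v

MeetsEveryBlock : ∀ {n k} → Divisor n → (Fin n → Fin (suc k)) → Set
MeetsEveryBlock {k = k} D π = ∀ (j : Fin (suc k)) → ∃[ v ] (π v ≡ j × ¬ (D v ≡ + 0))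

-- Suppose D₁ = D₀ + L f is effective and let M be the set of vertices where
-- f is minimal.  At u ∈ M we have (L f)(u) = −Σ_w adj(u,w)(f w − f u), while
-- D₀(u) = Σ_w adj(u,w)·sep(u,w), where sep(u,w) counts the cuts with u on the
-- chosen side and w on the other; along a chain of nested cuts sep ≤ 1.
-- Walking down the chain we pick, at each cut, the opposite side if it meets
-- M and the chosen side otherwise.  This ends in a connected set P that
-- contains a vertex v ∈ M and the whole block of Π through v, such that for
-- u ∈ P ∩ M no cut separates u from M or from P.  There every term of D₁(u)
-- is ≤ 0, so effectiveness forces D₁(u) = 0 and all neighbours of u in P to
-- lie in M; by connectivity P ⊆ M, so D₁ vanishes on the block of v.

module Submission where

open import Defs hiding (sym)
open import Data.Nat as ℕ using (ℕ; zero; suc; _≤_; _∸_)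
import Data.Nat.Properties as ℕP
open import Data.Integer as ℤ using (ℤ; +_; -_)
import Data.Integer.Properties as ℤP
open import Data.Integer.Tactic.RingSolver using (solve-∀)
open import Data.Fin using (Fin; zero; suc; _≟_)
import Data.Fin.Properties as FinP
open import Data.Bool using (Bool; true; false; if_then_else_; not; _∧_; _∨_)
import Data.Bool.Properties as BoolP
open import Data.Vec using (Vec; []; _∷_)
open import Data.Vec.Relation.Unary.All as All using (All; []; _∷_)
open import Data.List using (allFin)
import Data.List.Relation.Unary.All as ListAll
open import Data.List.Membership.Propositional.Properties using (∈-allFin)
open import Data.List.Extrema ℤP.≤-totalOrder using (argmin; f[argmin]≤f[xs])
open import Data.Product using (Σ; ∃-syntax; _×_; _,_; proj₁; proj₂)
open import Data.Sum using (_⊎_; inj₁; inj₂)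
open import Function.Bundles using (Equivalence)
open import Relation.Binary.PropositionalEquality
open import Relation.Nullary using (¬_; Dec; yes; no; does; contradiction)
open import Relation.Nullary.Decidable using (_×-dec_; dec-true)
open import Algebra.Properties.CommutativeSemigroup ℕP.+-commutativeSemigroup
  using () renaming (interchange to ℕ-+-interchange)
open import Algebra.Properties.CommutativeSemigroup ℤP.+-commutativeSemigroup
  using () renaming (interchange to ℤ-+-interchange)
open import Algebra.Properties.AbelianGroup ℤP.+-0-abelianGroup
  using () renaming (identityʳ-unique to ℤ-identityʳ-unique)

∑-cong : ∀ {n} {g h : Fin n → ℕ} → (∀ i → g i ≡ h i) → ∑ g ≡ ∑ h
∑-cong {zero} e = refl
∑-cong {suc n} e = cong₂ ℕ._+_ (e zero) (∑-cong (λ i → e (suc i)))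

∑-zero : ∀ {n} (g : Fin n → ℕ) → (∀ i → g i ≡ 0) → ∑ g ≡ 0
∑-zero {zero} g e = refl
∑-zero {suc n} g e rewrite e zero = ∑-zero (λ i → g (suc i)) (λ i → e (suc i))

∑-+ : ∀ {n} (g h : Fin n → ℕ) → ∑ (λ i → g i ℕ.+ h i) ≡ ∑ g ℕ.+ ∑ h
∑-+ {zero} g h = refl
∑-+ {suc n} g h rewrite ∑-+ (λ i → g (suc i)) (λ i → h (suc i)) =
  ℕ-+-interchange (g zero) (h zero) _ _

∑-mono : ∀ {n} {g h : Fin n → ℕ} → (∀ i → g i ≤ h i) → ∑ g ≤ ∑ h
∑-mono {zero} e = ℕ.z≤n
∑-mono {suc n} e = ℕP.+-mono-≤ (e zero) (∑-mono (λ i → e (suc i)))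

∑-mono-< : ∀ {n} {g h : Fin n → ℕ} → (∀ i → g i ≤ h i) →
           (w : Fin n) → g w ℕ.< h w → ∑ g ℕ.< ∑ h
∑-mono-< {suc n} e zero lt = ℕP.+-mono-<-≤ lt (∑-mono (λ i → e (suc i)))
∑-mono-< {suc n} e (suc w) lt = ℕP.+-mono-≤-< (e zero) (∑-mono-< (λ i → e (suc i)) w lt)

∑ℤ-cong : ∀ {n} {g h : Fin n → ℤ} → (∀ i → g i ≡ h i) → ∑ℤ g ≡ ∑ℤ h
∑ℤ-cong {zero} e = refl
∑ℤ-cong {suc n} e = cong₂ ℤ._+_ (e zero) (∑ℤ-cong (λ i → e (suc i)))

∑ℤ-+ : ∀ {n} (g h : Fin n → ℤ) → ∑ℤ (λ i → g i ℤ.+ h i) ≡ ∑ℤ g ℤ.+ ∑ℤ h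
∑ℤ-+ {zero} g h = refl
∑ℤ-+ {suc n} g h rewrite ∑ℤ-+ (λ i → g (suc i)) (λ i → h (suc i)) =
  ℤ-+-interchange (g zero) (h zero) _ _

∑ℤ-*ʳ : ∀ {n} (g : Fin n → ℤ) c → ∑ℤ (λ i → g i ℤ.* c) ≡ ∑ℤ g ℤ.* c
∑ℤ-*ʳ {zero} g c = refl
∑ℤ-*ʳ {suc n} g c rewrite ∑ℤ-*ʳ (λ i → g (suc i)) c = sym (ℤP.*-distribʳ-+ c (g zero) _)

∑ℤ-neg : ∀ {n} (g : Fin n → ℤ) → ∑ℤ (λ i → - g i) ≡ - ∑ℤ g
∑ℤ-neg {zero} g = refl
∑ℤ-neg {suc n} g rewrite ∑ℤ-neg (λ i → g (suc i)) = sym (ℤP.neg-distrib-+ (g zero) _)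

∑ℤ-pos : ∀ {n} (g : Fin n → ℕ) → ∑ℤ (λ i → + g i) ≡ + ∑ g
∑ℤ-pos {zero} g = refl
∑ℤ-pos {suc n} g rewrite ∑ℤ-pos (λ i → g (suc i)) = sym (ℤP.pos-+ (g zero) _)

∑ℤ-pointMass : ∀ {n} (u : Fin n) (c : ℤ) →
               ∑ℤ (λ w → if does (u ≟ w) then c else + 0) ≡ c
∑ℤ-pointMass {suc n} zero c = begin
  c ℤ.+ ∑ℤ (λ (_ : Fin n) → + 0)  ≡⟨ cong (λ s → c ℤ.+ s) (∑ℤ-pos {n} (λ _ → 0)) ⟩
  c ℤ.+ + ∑ (λ (_ : Fin n) → 0)   ≡⟨ cong (λ s → c ℤ.+ + s) (∑-zero {n} _ (λ _ → refl)) ⟩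
  c ℤ.+ + 0                       ≡⟨ ℤP.+-identityʳ c ⟩
  c                               ∎
  where open ≡-Reasoning
∑ℤ-pointMass {suc n} (suc u) c = trans (ℤP.+-identityˡ _) (∑ℤ-pointMass u c)

-- The Laplacian.  Off the diagonal L u w = -adj u w; since there are no
-- loops, the diagonal entry deg u is a point mass added to -adj u u = 0.
laplacian-entry : ∀ {n} (G : Graph n) u w →
  Laplacian G u w ≡ (if does (u ≟ w) then + deg G u else + 0) ℤ.+ - (+ adj G u w)
laplacian-entry G u w with u ≟ w
... | yes refl rewrite noLoop G u = sym (ℤP.+-identityʳ (+ deg G u))
... | no _ = sym (ℤP.+-identityˡ _)

laplacian-offDiagonal : ∀ {n} (G : Graph n) {u w} → ¬ u ≡ w → Laplacian G u w ≡ - (+ adj G u w)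
laplacian-offDiagonal G {u} {w} u≢w with u ≟ w
... | yes u≡w = contradiction u≡w u≢w
... | no _ = refl

laplacian-rowSum : ∀ {n} (G : Graph n) u → ∑ℤ (Laplacian G u) ≡ + 0
laplacian-rowSum G u = begin
  ∑ℤ (Laplacian G u)
    ≡⟨ ∑ℤ-cong (laplacian-entry G u) ⟩
  ∑ℤ (λ w → (if does (u ≟ w) then + deg G u else + 0) ℤ.+ - (+ adj G u w))
    ≡⟨ ∑ℤ-+ (λ w → if does (u ≟ w) then + deg G u else + 0) (λ w → - (+ adj G u w)) ⟩
  ∑ℤ (λ w → if does (u ≟ w) then + deg G u else + 0) ℤ.+ ∑ℤ (λ w → - (+ adj G u w))
    ≡⟨ cong₂ ℤ._+_ (∑ℤ-pointMass u (+ deg G u)) (∑ℤ-neg (λ w → + adj G u w)) ⟩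
  + deg G u ℤ.+ - ∑ℤ (λ w → + adj G u w)
    ≡⟨ cong (λ s → + deg G u ℤ.+ - s) (∑ℤ-pos (adj G u)) ⟩
  + deg G u ℤ.+ - (+ deg G u)
    ≡⟨ ℤP.+-inverseʳ (+ deg G u) ⟩
  + 0 ∎
  where open ≡-Reasoning

applyL-at-minimum : ∀ {n} (G : Graph n) (f : Fin n → ℤ) (u : Fin n) (d : Fin n → ℕ) →
  (∀ w → f w ≡ f u ℤ.+ + d w) →
  applyL G f u ≡ - (+ ∑ (λ w → adj G u w ℕ.* d w))
applyL-at-minimum G f u d f≡ = begin
  ∑ℤ (λ w → Laplacian G u w ℤ.* f w)
    ≡⟨ ∑ℤ-cong entry ⟩
  ∑ℤ (λ w → Laplacian G u w ℤ.* f u ℤ.+ - (+ (adj G u w ℕ.* d w)))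
    ≡⟨ ∑ℤ-+ (λ w → Laplacian G u w ℤ.* f u) (λ w → - (+ (adj G u w ℕ.* d w))) ⟩
  ∑ℤ (λ w → Laplacian G u w ℤ.* f u) ℤ.+ ∑ℤ (λ w → - (+ (adj G u w ℕ.* d w)))
    ≡⟨ cong₂ ℤ._+_ (∑ℤ-*ʳ (Laplacian G u) (f u)) (∑ℤ-neg (λ w → + (adj G u w ℕ.* d w))) ⟩
  ∑ℤ (Laplacian G u) ℤ.* f u ℤ.+ - ∑ℤ (λ w → + (adj G u w ℕ.* d w))
    ≡⟨ cong₂ (λ r s → r ℤ.* f u ℤ.+ - s) (laplacian-rowSum G u) (∑ℤ-pos (λ w → adj G u w ℕ.* d w)) ⟩
  + 0 ℤ.* f u ℤ.+ - (+ ∑ (λ w → adj G u w ℕ.* d w))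
    ≡⟨ ℤP.+-identityˡ _ ⟩
  - (+ ∑ (λ w → adj G u w ℕ.* d w)) ∎
  where
  open ≡-Reasoning
  -- d vanishes at u itself, so only the off-diagonal entries see d.
  weighted : ∀ w → Dec (u ≡ w) → Laplacian G u w ℤ.* + d w ≡ - (+ (adj G u w ℕ.* d w))
  weighted w (yes refl) rewrite ℤP.+-injective (ℤ-identityʳ-unique (f u) (+ d u) (sym (f≡ u))) =
    trans (ℤP.*-zeroʳ (Laplacian G u u)) (cong (λ m → - (+ m)) (sym (ℕP.*-zeroʳ (adj G u u))))
  weighted w (no u≢w) = begin
    Laplacian G u w ℤ.* + d w     ≡⟨ cong (ℤ._* + d w) (laplacian-offDiagonal G u≢w) ⟩
    - (+ adj G u w) ℤ.* + d w     ≡⟨ sym (ℤP.neg-distribˡ-* (+ adj G u w) (+ d w)) ⟩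
    - (+ adj G u w ℤ.* + d w)     ≡⟨ cong -_ (sym (ℤP.pos-* (adj G u w) (d w))) ⟩
    - (+ (adj G u w ℕ.* d w))     ∎
  entry : ∀ w → Laplacian G u w ℤ.* f w ≡ Laplacian G u w ℤ.* f u ℤ.+ - (+ (adj G u w ℕ.* d w))
  entry w rewrite f≡ w = trans (ℤP.*-distribˡ-+ (Laplacian G u w) (f u) (+ d w))
                               (cong (λ s → Laplacian G u w ℤ.* f u ℤ.+ s) (weighted w (u ≟ w)))

true≢false : ¬ true ≡ false
true≢false ()

-- Cuts.  We name the two sides of a cut by a Boolean (true = A, false = B),
-- so that the boundary divisor's choice X_i is side c x and the opposite
-- side is side c (not x).
side : ∀ {n} → Cut n → Bool → VSet n
side c true = A c
side c false = B c

χ-cases : ∀ {n} (c : Cut n) x v →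
  (v ∈ side c x × χ c x v ≡ 1) ⊎ (side c x v ≡ false × χ c x v ≡ 0)
χ-cases c true v with A c v
... | true = inj₁ (refl , refl)
... | false = inj₂ (refl , refl)
χ-cases c false v with B c v
... | true = inj₁ (refl , refl)
... | false = inj₂ (refl , refl)

χ-off : ∀ {n} (c : Cut n) x v → side c x v ≡ false → χ c x v ≡ 0
χ-off c true v v∉A rewrite v∉A = refl
χ-off c false v v∉B rewrite v∉B = refl

Disjoint : ∀ {n} → Cut n → Set
Disjoint c = ∀ v → (A c v ∧ B c v) ≡ false

sides-disjoint : ∀ {n} {c : Cut n} → Disjoint c → ∀ x v → v ∈ side c x → side c (not x) v ≡ false
sides-disjoint {c = c} d true v v∈A = subst (λ a → (a ∧ B c v) ≡ false) v∈A (d v)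
sides-disjoint {c = c} d false v v∈B =
  trans (sym (BoolP.∧-identityʳ (A c v))) (subst (λ b → (A c v ∧ b) ≡ false) v∈B (d v))

sides-separate : ∀ {n} {c : Cut n} {u w} → Disjoint c → ∀ x y →
  u ∈ side c x → w ∈ side c (not x) → side c y u ≡ false ⊎ side c y w ≡ false
sides-separate {c = c} d true true u∈A w∈B = inj₂ (sides-disjoint {c = c} d false _ w∈B)
sides-separate {c = c} d true false u∈A w∈B = inj₁ (sides-disjoint {c = c} d true _ u∈A)
sides-separate {c = c} d false true u∈B w∈A = inj₁ (sides-disjoint {c = c} d false _ u∈B)
sides-separate {c = c} d false false u∈B w∈A = inj₂ (sides-disjoint {c = c} d true _ w∈A)

module _ {n} {G : Graph n} {S : VSet n} {c : Cut n} (isCut : IsCutOf G S c) where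

  cut-disjoint : Disjoint c
  cut-disjoint = proj₁ (proj₂ isCut)

  cut-side⊆ : ∀ x v → v ∈ side c x → v ∈ S
  cut-side⊆ true v v∈A = Equivalence.from (proj₁ isCut v) (subst (λ a → (a ∨ B c v) ≡ true) (sym v∈A) refl)
  cut-side⊆ false v v∈B = Equivalence.from (proj₁ isCut v) (trans (cong (A c v ∨_) v∈B) (BoolP.∨-zeroʳ (A c v)))

  cut-covers : ∀ x v → v ∈ S → side c (not x) v ≡ false → v ∈ side c x
  cut-covers x v v∈S v∉Y with Equivalence.to (proj₁ isCut v) v∈S
  cut-covers true v v∈S v∉B | A∨B rewrite v∉B = trans (sym (BoolP.∨-identityʳ (A c v))) A∨B
  cut-covers false v v∈S v∉A | A∨B rewrite v∉A = A∨B

  cut-side-connected : ∀ x → ConnectedSet G (side c x)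
  cut-side-connected true = proj₁ (proj₂ (proj₂ isCut))
  cut-side-connected false = proj₂ (proj₂ (proj₂ isCut))

sep : ∀ {n m} → Vec (Cut n) m → Vec Bool m → Fin n → Fin n → ℕ
sep [] [] u w = 0
sep (c ∷ cs) (x ∷ xs) u w = χ c x u ℕ.* χ c (not x) w ℕ.+ sep cs xs u w

if-as-product : ∀ (b : Bool) a → (if b then a else 0) ≡ a ℕ.* (if b then 1 else 0)
if-as-product true a = sym (ℕP.*-identityʳ a)
if-as-product false a = sym (ℕP.*-zeroʳ a)

degAB-side : ∀ {n} (G : Graph n) (c : Cut n) → Disjoint c → ∀ x v → v ∈ side c x →
  degAB G c v ≡ ∑ (λ w → adj G v w ℕ.* χ c (not x) w)
degAB-side G c d true v v∈A rewrite v∈A = ∑-cong (λ w → if-as-product (B c w) (adj G v w))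
degAB-side G c d false v v∈B
  rewrite sides-disjoint {c = c} d false v v∈B | v∈B = ∑-cong (λ w → if-as-product (A c w) (adj G v w))

boundaryTerm : ∀ {n} (G : Graph n) (c : Cut n) → Disjoint c → ∀ x u →
  degAB G c u ℕ.* χ c x u ≡ ∑ (λ w → adj G u w ℕ.* (χ c x u ℕ.* χ c (not x) w))
boundaryTerm G c d x u with χ-cases c x u
... | inj₁ (u∈X , χ≡1) rewrite χ≡1 =
  trans (ℕP.*-identityʳ _)
        (trans (degAB-side G c d x u u∈X)
               (∑-cong (λ w → cong (adj G u w ℕ.*_) (sym (ℕP.*-identityˡ _)))))
... | inj₂ (_ , χ≡0) rewrite χ≡0 =
  trans (ℕP.*-zeroʳ (degAB G c u)) (sym (∑-zero (λ w → adj G u w ℕ.* 0) (λ w → ℕP.*-zeroʳ (adj G u w))))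

boundarySum-sep : ∀ {n m} (G : Graph n) (cs : Vec (Cut n) m) xs u → All Disjoint cs →
  boundarySum G cs xs u ≡ ∑ (λ w → adj G u w ℕ.* sep cs xs u w)
boundarySum-sep G [] [] u [] = sym (∑-zero (λ w → adj G u w ℕ.* 0) (λ w → ℕP.*-zeroʳ (adj G u w)))
boundarySum-sep G (c ∷ cs) (x ∷ xs) u (d ∷ ds) = begin
  degAB G c u ℕ.* χ c x u ℕ.+ boundarySum G cs xs u
    ≡⟨ cong₂ ℕ._+_ (boundaryTerm G c d x u) (boundarySum-sep G cs xs u ds) ⟩
  ∑ (λ w → adj G u w ℕ.* (χ c x u ℕ.* χ c (not x) w)) ℕ.+ ∑ (λ w → adj G u w ℕ.* sep cs xs u w)
    ≡⟨ sym (∑-+ (λ w → adj G u w ℕ.* (χ c x u ℕ.* χ c (not x) w)) (λ w → adj G u w ℕ.* sep cs xs u w)) ⟩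
  ∑ (λ w → adj G u w ℕ.* (χ c x u ℕ.* χ c (not x) w) ℕ.+ adj G u w ℕ.* sep cs xs u w)
    ≡⟨ ∑-cong (λ w → sym (ℕP.*-distribˡ-+ (adj G u w) _ _)) ⟩
  ∑ (λ w → adj G u w ℕ.* sep (c ∷ cs) (x ∷ xs) u w) ∎
  where open ≡-Reasoning

chain-head : ∀ {n} {G : Graph n} {prev c : Cut n} →
  IsCutOf G (A prev) c ⊎ IsCutOf G (B prev) c → Σ Bool λ y → IsCutOf G (side prev y) c
chain-head (inj₁ isCut) = true , isCut
chain-head (inj₂ isCut) = false , isCut

CutWithin : ∀ {n} → VSet n → Cut n → Set
CutWithin Q c = ∀ x v → v ∈ side c x → v ∈ Q

chain-within : ∀ {n m} {G : Graph n} {Q c} {cs : Vec (Cut n) m} →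
  IsCutOf G Q c → ChainFrom G c cs → All (CutWithin Q) (c ∷ cs)
chain-within {cs = []} isCut _ = cut-side⊆ isCut ∷ []
chain-within {cs = c' ∷ cs} isCut (head , chain) with chain-head head
... | y , isCut' = cut-side⊆ isCut ∷ All.map (λ within x v v∈ → cut-side⊆ isCut y v (within x v v∈))
                                         (chain-within isCut' chain)

chain-disjoint : ∀ {n m} {G : Graph n} {c} {cs : Vec (Cut n) m} → ChainFrom G c cs → All Disjoint cs
chain-disjoint {cs = []} _ = []
chain-disjoint {cs = c' ∷ cs} (head , chain) = cut-disjoint (proj₂ (chain-head head)) ∷ chain-disjoint chain

valid-disjoint : ∀ {n m} {G : Graph n} {cs : Vec (Cut n) m} → ValidSeq G cs → All Disjoint cs
valid-disjoint {cs = []} _ = []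
valid-disjoint {cs = c ∷ cs} (isCut , chain) = cut-disjoint isCut ∷ chain-disjoint chain

off-side : ∀ {n} {Q : VSet n} {c} → CutWithin Q c → ∀ x v → Q v ≡ false → side c x v ≡ false
off-side within x v v∉Q = BoolP.¬-not (λ v∈X → true≢false (trans (sym (within x v v∈X)) v∉Q))

sep-outside : ∀ {n m} {Q : VSet n} (cs : Vec (Cut n) m) xs {u w} → All (CutWithin Q) cs →
  Q u ≡ false ⊎ Q w ≡ false → sep cs xs u w ≡ 0
sep-outside [] [] [] _ = refl
sep-outside {Q = Q} (c ∷ cs) (x ∷ xs) {u} {w} (within ∷ withins) outside =
  cong₂ ℕ._+_ (firstTerm outside) (sep-outside cs xs withins outside)
  where
  firstTerm : Q u ≡ false ⊎ Q w ≡ false → χ c x u ℕ.* χ c (not x) w ≡ 0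
  firstTerm (inj₁ u∉Q) = cong (ℕ._* χ c (not x) w) (χ-off c x u (off-side within x u u∉Q))
  firstTerm (inj₂ w∉Q) = trans (cong (χ c x u ℕ.*_) (χ-off c (not x) w (off-side within (not x) w w∉Q)))
                               (ℕP.*-zeroʳ (χ c x u))

-- Once a cut separates u from w, no later cut of the chain does: the later
-- cuts all lie inside one side of it, which misses u or w.
separated-once : ∀ {n m} {G : Graph n} {c} (cs : Vec (Cut n) m) xs x {u w} → Disjoint c →
  ChainFrom G c cs → u ∈ side c x → w ∈ side c (not x) → sep cs xs u w ≡ 0
separated-once [] [] x d _ u∈X w∈Y = refl
separated-once (c' ∷ cs) xs x d (head , chain) u∈X w∈Y with chain-head head
... | y , isCut' = sep-outside (c' ∷ cs) xs (chain-within isCut' chain) (sides-separate d x y u∈X w∈Y)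

sep≤1 : ∀ {n m} {G : Graph n} c (cs : Vec (Cut n) m) x xs u w → Disjoint c →
  ChainFrom G c cs → sep (c ∷ cs) (x ∷ xs) u w ≤ 1
sep≤1-chain : ∀ {n m} {G : Graph n} c (cs : Vec (Cut n) m) xs u w →
  ChainFrom G c cs → sep cs xs u w ≤ 1

sep≤1 c cs x xs u w d chain with χ-cases c x u | χ-cases c (not x) w
... | inj₁ (u∈X , χu≡1) | inj₁ (w∈Y , χw≡1)
  rewrite χu≡1 | χw≡1 | separated-once cs xs x d chain u∈X w∈Y = ℕP.≤-refl
... | inj₂ (_ , χu≡0) | _ rewrite χu≡0 = sep≤1-chain c cs xs u w chain
... | inj₁ _ | inj₂ (_ , χw≡0) rewrite χw≡0 | ℕP.*-zeroʳ (χ c x u) = sep≤1-chain c cs xs u w chain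

sep≤1-chain c [] [] u w _ = ℕ.z≤n
sep≤1-chain c (c' ∷ cs) (x' ∷ xs) u w (head , chain) =
  sep≤1 c' cs x' xs u w (cut-disjoint (proj₂ (chain-head head))) chain

relabel : ∀ {n} → Cut n → ℕ → (Fin n → ℕ) → Fin n → ℕ
relabel c i cur v = if B c v then i else cur v

-- Invariant of the labelling while cuts are applied: before the i-th cut all
-- labels are below i, and P is exactly the set of vertices with one label.
record Tracks {n} (P : VSet n) (i : ℕ) (cur : Fin n → ℕ) : Set where
  field
    level : ℕ
    level<i : level ℕ.< i
    labels<i : ∀ v → cur v ℕ.< i
    level⇒∈ : ∀ v → cur v ≡ level → v ∈ P
    ∈⇒level : ∀ v → v ∈ P → cur v ≡ level

module _ {n} {P : VSet n} {i : ℕ} {cur : Fin n → ℕ} (tracks : Tracks P i cur) where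
  open Tracks tracks

  relabel<1+i : ∀ c v → relabel c i cur v ℕ.< suc i
  relabel<1+i c v with B c v
  ... | true = ℕP.n<1+n i
  ... | false = ℕP.m<n⇒m<1+n (labels<i v)

  tracks-class : ∀ {u v} → v ∈ P → cur u ≡ cur v → u ∈ P
  tracks-class v∈P cu≡cv = level⇒∈ _ (trans cu≡cv (∈⇒level _ v∈P))

  track-outside : ∀ c → (∀ v → B c v ≡ true → P v ≡ false) → Tracks P (suc i) (relabel c i cur)
  track-outside c B∩P=∅ = record
    { level = level ; level<i = ℕP.m<n⇒m<1+n level<i ; labels<i = relabel<1+i c
    ; level⇒∈ = level⇒∈′ ; ∈⇒level = ∈⇒level′ }
    where
    level⇒∈′ : ∀ v → relabel c i cur v ≡ level → v ∈ P
    level⇒∈′ v with B c v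
    ... | true = λ i≡level → contradiction (sym i≡level) (ℕP.<⇒≢ level<i)
    ... | false = level⇒∈ v
    ∈⇒level′ : ∀ v → v ∈ P → relabel c i cur v ≡ level
    ∈⇒level′ v v∈P with B c v in v∈B
    ... | true = contradiction (trans (sym v∈P) (B∩P=∅ v v∈B)) true≢false
    ... | false = ∈⇒level v v∈P

  track-side : ∀ {G : Graph n} {c} → IsCutOf G P c → ∀ y → Tracks (side c y) (suc i) (relabel c i cur)
  track-side {c = c} isCut true = record
    { level = level ; level<i = ℕP.m<n⇒m<1+n level<i ; labels<i = relabel<1+i c
    ; level⇒∈ = level⇒∈′ ; ∈⇒level = ∈⇒level′ }
    where
    level⇒∈′ : ∀ v → relabel c i cur v ≡ level → v ∈ A c
    level⇒∈′ v with B c v in v∈B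
    ... | true = λ i≡level → contradiction (sym i≡level) (ℕP.<⇒≢ level<i)
    ... | false = λ cv≡level → cut-covers isCut true v (level⇒∈ v cv≡level) v∈B
    ∈⇒level′ : ∀ v → v ∈ A c → relabel c i cur v ≡ level
    ∈⇒level′ v v∈A rewrite sides-disjoint {c = c} (cut-disjoint isCut) true v v∈A =
      ∈⇒level v (cut-side⊆ isCut true v v∈A)
  track-side {c = c} isCut false = record
    { level = i ; level<i = ℕP.n<1+n i ; labels<i = relabel<1+i c
    ; level⇒∈ = level⇒∈′ ; ∈⇒level = ∈⇒level′ }
    where
    level⇒∈′ : ∀ v → relabel c i cur v ≡ i → v ∈ B c
    level⇒∈′ v with B c v
    ... | true = λ _ → refl
    ... | false = λ cv≡i → contradiction cv≡i (ℕP.<⇒≢ (labels<i v))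
    ∈⇒level′ : ∀ v → v ∈ B c → relabel c i cur v ≡ i
    ∈⇒level′ v v∈B rewrite v∈B = refl

class-elsewhere : ∀ {n m} {P Q : VSet n} {i cur} (cs : Vec (Cut n) m) → All (CutWithin Q) cs →
  (∀ v → v ∈ Q → P v ≡ false) → Tracks P i cur →
  ∀ {u v} → v ∈ P → labelFrom i cs (cur u) u ≡ labelFrom i cs (cur v) v → u ∈ P
class-elsewhere [] [] Q∩P=∅ tracks v∈P = tracks-class tracks v∈P
class-elsewhere (c ∷ cs) (within ∷ withins) Q∩P=∅ tracks =
  class-elsewhere cs withins Q∩P=∅ (track-outside tracks c (λ v v∈B → Q∩P=∅ v (within false v v∈B)))

data Continuation {n} (G : Graph n) (P : VSet n) : ∀ {m} → Vec (Cut n) m → Set where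
  splits : ∀ {m c} {cs : Vec (Cut n) m} → IsCutOf G P c → ChainFrom G c cs →
           Continuation G P (c ∷ cs)
  elsewhere : ∀ {m} {cs : Vec (Cut n) m} (Q : VSet n) → (∀ v → v ∈ Q → P v ≡ false) →
              All (CutWithin Q) cs → Continuation G P cs

continue-in-side : ∀ {n m} {G : Graph n} {S c} {cs : Vec (Cut n) m} →
  IsCutOf G S c → ChainFrom G c cs → ∀ y → Continuation G (side c y) cs
continue-in-side {cs = []} isCut _ y = elsewhere (λ _ → false) (λ v ()) []
continue-in-side {G = G} {c = c} {cs = c' ∷ cs} isCut (head , chain) y with chain-head head
... | y' , isCut' = continue y y' isCut'
  where
  d : Disjoint c
  d = cut-disjoint isCut
  continue : ∀ y y' → IsCutOf G (side c y') c' → Continuation G (side c y) (c' ∷ cs)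
  continue true true isCut' = splits isCut' chain
  continue false false isCut' = splits isCut' chain
  continue true false isCut' = elsewhere (B c) (sides-disjoint {c = c} d false) (chain-within isCut' chain)
  continue false true isCut' = elsewhere (A c) (sides-disjoint {c = c} d true) (chain-within isCut' chain)

-- Fix a set M of vertices (later: where f is minimal).  Going
-- down the chain we keep a connected set containing a vertex of M; at a cut
-- with chosen side X and opposite side Y we move into Y if Y meets M, and into
-- X otherwise.  The set where we stop contains the final class of its anchor
-- vertex, and no cut separates one of its M-vertices (on the chosen side)
-- from a vertex of M or of the set itself.
module Descent {n} (G : Graph n) (M : VSet n) where

  -- The outcome of the descent from P, where the cuts cs are still to be
  -- applied starting with label i and current labels cur.

  record Block {m} (P : VSet n) (i : ℕ) (cur : Fin n → ℕ)
               (cs : Vec (Cut n) m) (xs : Vec Bool m) : Set where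
    field
      part : VSet n
      part⊆P : ∀ v → v ∈ part → v ∈ P
      connected : ConnectedSet G part
      anchor : Fin n
      anchor∈part : anchor ∈ part
      anchor∈M : anchor ∈ M
      class⊆part : ∀ u → labelFrom i cs (cur u) u ≡ labelFrom i cs (cur anchor) anchor → u ∈ part
      sheltered : ∀ u w → u ∈ part → u ∈ M → w ∈ M ⊎ w ∈ part → sep cs xs u w ≡ 0

  extend : ∀ {m} {P i cur c} {cs : Vec (Cut n) m} {x xs y} → IsCutOf G P c →
    (b : Block (side c y) (suc i) (relabel c i cur) cs xs) →
    (∀ u w → u ∈ Block.part b → u ∈ M → w ∈ M ⊎ w ∈ Block.part b →
       χ c x u ℕ.* χ c (not x) w ≡ 0) →
    Block P i cur (c ∷ cs) (x ∷ xs)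
  extend {y = y} isCut b notSeparated = record
    { part = part ; part⊆P = λ v v∈ → cut-side⊆ isCut y v (part⊆P v v∈)
    ; connected = connected ; anchor = anchor ; anchor∈part = anchor∈part ; anchor∈M = anchor∈M
    ; class⊆part = class⊆part
    ; sheltered = λ u w u∈ u∈M w∈ → cong₂ ℕ._+_ (notSeparated u w u∈ u∈M w∈) (sheltered u w u∈ u∈M w∈) }
    where open Block b

  descend : ∀ {m} (P : VSet n) (cs : Vec (Cut n) m) xs i cur → Tracks P i cur →
    ConnectedSet G P → ∀ v → v ∈ P → v ∈ M → Continuation G P cs → Block P i cur cs xs
  descend P cs xs i cur tracks conn v v∈P v∈M (elsewhere Q Q∩P=∅ withins) = record
    { part = P ; part⊆P = λ _ v∈ → v∈ ; connected = conn
    ; anchor = v ; anchor∈part = v∈P ; anchor∈M = v∈M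
    ; class⊆part = λ u → class-elsewhere cs withins Q∩P=∅ tracks v∈P
    ; sheltered = λ u w u∈P _ _ → sep-outside cs xs withins (inj₁ (outside u u∈P)) }
    where
    outside : ∀ u → u ∈ P → Q u ≡ false
    outside u u∈P = BoolP.¬-not (λ u∈Q → true≢false (trans (sym u∈P) (Q∩P=∅ u u∈Q)))
  descend P (c ∷ cs) (x ∷ xs) i cur tracks conn v v∈P v∈M (splits isCut chain) =
    choose (FinP.any? (λ w → (side c (not x) w BoolP.≟ true) ×-dec (M w BoolP.≟ true)))
    where
    d : Disjoint c
    d = cut-disjoint isCut

    enter : ∀ y w → w ∈ side c y → w ∈ M → Block (side c y) (suc i) (relabel c i cur) cs xs
    enter y w w∈ w∈M = descend (side c y) cs xs (suc i) (relabel c i cur) (track-side tracks isCut y)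
                               (cut-side-connected isCut y) w w∈ w∈M (continue-in-side isCut chain y)

    choose : Dec (Σ (Fin n) λ w → w ∈ side c (not x) × w ∈ M) → Block P i cur (c ∷ cs) (x ∷ xs)
    -- Y meets M: descend into Y; the block lies in Y, so none of its
    -- vertices is on the chosen side X.
    choose (yes (w , w∈Y , w∈M)) = extend {y = not x} isCut b notSeparated
      where
      b : Block (side c (not x)) (suc i) (relabel c i cur) cs xs
      b = enter (not x) w w∈Y w∈M
      notSeparated : ∀ u w → u ∈ Block.part b → u ∈ M → w ∈ M ⊎ w ∈ Block.part b →
                     χ c x u ℕ.* χ c (not x) w ≡ 0
      notSeparated u w u∈ _ _ =
        cong (ℕ._* χ c (not x) w) (χ-off c x u (subst (λ z → side c z u ≡ false) (BoolP.not-involutive x)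
          (sides-disjoint {c = c} d (not x) u (Block.part⊆P b u u∈))))
    -- Y misses M: descend into X; vertices of M and of the block (inside X)
    -- are not on the opposite side Y.
    choose (no Y∩M=∅) = extend {y = x} isCut b notSeparated
      where
      v∈X : v ∈ side c x
      v∈X = cut-covers isCut x v v∈P (BoolP.¬-not (λ v∈Y → Y∩M=∅ (v , v∈Y , v∈M)))
      b : Block (side c x) (suc i) (relabel c i cur) cs xs
      b = enter x v v∈X v∈M
      notOpposite : ∀ w → w ∈ M ⊎ w ∈ Block.part b → side c (not x) w ≡ false
      notOpposite w (inj₁ w∈M) = BoolP.¬-not (λ w∈Y → Y∩M=∅ (w , w∈Y , w∈M))
      notOpposite w (inj₂ w∈) = sides-disjoint {c = c} d x w (Block.part⊆P b w w∈)
      notSeparated : ∀ u w → u ∈ Block.part b → u ∈ M → w ∈ M ⊎ w ∈ Block.part b →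
                     χ c x u ℕ.* χ c (not x) w ≡ 0
      notSeparated u w _ _ w∈ = trans (cong (χ c x u ℕ.*_) (χ-off c (not x) w (notOpposite w w∈)))
                                      (ℕP.*-zeroʳ (χ c x u))

  descend-all : ∀ {m} (cs : Vec (Cut n) m) xs → ValidSeq G cs → Connected G →
    ∀ v → v ∈ M → Block full 1 (λ _ → 0) cs xs
  descend-all cs xs valid conn v v∈M =
    descend full cs xs 1 (λ _ → 0) tracks conn v refl v∈M (start cs valid)
    where
    tracks : Tracks full 1 (λ _ → 0)
    tracks = record { level = 0 ; level<i = ℕ.s≤s ℕ.z≤n ; labels<i = λ _ → ℕ.s≤s ℕ.z≤n
                    ; level⇒∈ = λ _ _ → refl ; ∈⇒level = λ _ _ → refl }
    start : ∀ {m} (cs : Vec (Cut n) m) → ValidSeq G cs → Continuation G full cs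
    start [] _ = elsewhere (λ _ → false) (λ v ()) []
    start (c ∷ cs) (isCut , chain) = splits isCut chain

minimum : ∀ {n} (f : Fin (suc n) → ℤ) → Σ (Fin (suc n)) λ v → ∀ w → f v ℤ.≤ f w
minimum {n} f = argmin f zero (allFin (suc n)) ,
  λ w → ListAll.lookup (f[argmin]≤f[xs] {f = f} zero (allFin (suc n))) (∈-allFin w)

connected-closure : ∀ {n} {G : Graph n} {P : VSet n} (M : VSet n) →
  (∀ u w → u ∈ P → u ∈ M → w ∈ P → 0 ℕ.< adj G u w → w ∈ M) →
  ∀ {u t} → Reach G P u t → u ∈ P → u ∈ M → t ∈ M
connected-closure M closed here u∈P u∈M = u∈M
connected-closure M closed (step {u} {w} edge w∈P path) u∈P u∈M =
  connected-closure M closed path w∈P (closed u w u∈P u∈M w∈P edge)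

sep≤1-valid : ∀ {n m} {G : Graph n} (cs : Vec (Cut n) m) xs u w → ValidSeq G cs → sep cs xs u w ≤ 1
sep≤1-valid [] [] u w _ = ℕ.z≤n
sep≤1-valid (c ∷ cs) (x ∷ xs) u w (isCut , chain) = sep≤1 c cs x xs u w (cut-disjoint isCut) chain

module AtMinimum {n} (G : Graph n) {m} (cs : Vec (Cut n) m) (xs : Vec Bool m)
  (valid : ValidSeq G cs) (D₁ : Divisor n) (f : Fin n → ℤ)
  (D₁≡ : ∀ u → D₁ u ≡ + boundarySum G cs xs u ℤ.+ applyL G f u)
  (vmin : Fin n) (f-min : ∀ w → f vmin ℤ.≤ f w) where

  M : VSet n
  M w = does (f w ℤ.≤? f vmin)

  vmin∈M : vmin ∈ M
  vmin∈M = dec-true (f vmin ℤ.≤? f vmin) ℤP.≤-refl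

  M-minimal : ∀ u → u ∈ M → ∀ w → f u ℤ.≤ f w
  M-minimal u u∈M w with f u ℤ.≤? f vmin
  ... | yes fu≤fmin = ℤP.≤-trans fu≤fmin (f-min w)
  M-minimal u () w | no _

  ∉M-above : ∀ w → M w ≡ false → f vmin ℤ.< f w
  ∉M-above w w∉M with f w ℤ.≤? f vmin
  ... | no fw≰fmin = ℤP.≰⇒> fw≰fmin
  ∉M-above w () | yes _

  gap : Fin n → Fin n → ℕ
  gap u w = ℤ.∣ f w ℤ.- f u ∣

  gap-spec : ∀ {u w} → f u ℤ.≤ f w → f w ≡ f u ℤ.+ + gap u w
  gap-spec {u} {w} fu≤fw = begin
    f w                      ≡⟨ regroup (f u) (f w) ⟩
    f u ℤ.+ (f w ℤ.- f u)    ≡⟨ cong (λ z → f u ℤ.+ z) (sym (ℤP.0≤i⇒+∣i∣≡i (ℤP.i≤j⇒0≤j-i fu≤fw))) ⟩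
    f u ℤ.+ + gap u w        ∎
    where
    open ≡-Reasoning
    regroup : ∀ x y → y ≡ x ℤ.+ (y ℤ.- x)
    regroup = solve-∀

  gap-pos : ∀ {u w} → f u ℤ.< f w → 1 ≤ gap u w
  gap-pos {u} {w} fu<fw with gap u w in gap≡ | gap-spec {u} {w} (ℤP.<⇒≤ fu<fw)
  ... | suc _ | _ = ℕ.s≤s ℕ.z≤n
  ... | zero | fw≡fu+0 = contradiction (sym (trans fw≡fu+0 (ℤP.+-identityʳ (f u)))) (ℤP.<⇒≢ fu<fw)

  D₁-at-minimum : ∀ u → u ∈ M →
    D₁ u ≡ + ∑ (λ w → adj G u w ℕ.* sep cs xs u w) ℤ.- + ∑ (λ w → adj G u w ℕ.* gap u w)
  D₁-at-minimum u u∈M = trans (D₁≡ u)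
    (cong₂ ℤ._+_ (cong +_ (boundarySum-sep G cs xs u (valid-disjoint valid)))
                 (applyL-at-minimum G f u (gap u) (λ w → gap-spec (M-minimal u u∈M w))))

  -- Each cut contributes at most one
  -- unit per edge to D₀(u), and only on edges to vertices off M, while L f
  -- subtracts the full gap.  Hence D₁(u) = 0, and every neighbour of u in S
  -- is again a minimum vertex (otherwise D₁(u) < 0).
  sheltered-minimum : Effective D₁ → ∀ u → u ∈ M → (S : VSet n) →
    (∀ w → w ∈ M ⊎ w ∈ S → sep cs xs u w ≡ 0) →
    D₁ u ≡ + 0 × (∀ w → w ∈ S → 0 ℕ.< adj G u w → w ∈ M)
  sheltered-minimum effective u u∈M S shelter =
    trans (D₁-at-minimum u u∈M) (trans (cong (λ z → + a ℤ.- + z) (sym a≡b)) (ℤP.+-inverseʳ (+ a))) ,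
    neighbour
    where
    a b : ℕ
    a = ∑ (λ w → adj G u w ℕ.* sep cs xs u w)
    b = ∑ (λ w → adj G u w ℕ.* gap u w)
    sep≤gap : ∀ w → sep cs xs u w ≤ gap u w
    sep≤gap w with M w in w∈?M
    ... | true = ℕP.≤-trans (ℕP.≤-reflexive (shelter w (inj₁ w∈?M))) ℕ.z≤n
    ... | false = ℕP.≤-trans (sep≤1-valid cs xs u w valid)
                    (gap-pos (ℤP.≤-<-trans (M-minimal u u∈M vmin) (∉M-above w w∈?M)))
    term≤ : ∀ w → adj G u w ℕ.* sep cs xs u w ≤ adj G u w ℕ.* gap u w
    term≤ w = ℕP.*-monoʳ-≤ (adj G u w) (sep≤gap w)
    b≤a : b ≤ a
    b≤a = ℤP.drop‿+≤+ (ℤP.0≤i-j⇒j≤i (subst (ℤ._≤_ (+ 0)) (D₁-at-minimum u u∈M) (effective u)))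
    a≡b : a ≡ b
    a≡b = ℕP.≤-antisym (∑-mono term≤) b≤a
    neighbour : ∀ w → w ∈ S → 0 ℕ.< adj G u w → w ∈ M
    neighbour w w∈S edge with M w in w∈?M
    ... | true = refl
    ... | false = contradiction (∑-mono-< term≤ w strict) (ℕP.≤⇒≯ b≤a)
      where
      strict : adj G u w ℕ.* sep cs xs u w ℕ.< adj G u w ℕ.* gap u w
      strict rewrite shelter w (inj₂ w∈S) | ℕP.*-zeroʳ (adj G u w) =
        ℕP.*-mono-≤ edge (gap-pos (ℤP.≤-<-trans (M-minimal u u∈M vmin) (∉M-above w w∈?M)))

  -- Some class of the final partition lies outside the support of D₁:
  -- descend to a sheltered block containing a minimum vertex; by the local
  -- fact and connectivity all of it consists of minimum vertices, at each of
  -- which D₁ vanishes.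
  silent-class : Connected G → Effective D₁ →
    Σ (Fin n) λ v → ∀ u → finalLabel cs u ≡ finalLabel cs v → D₁ u ≡ + 0
  silent-class conn effective = anchor , silent
    where
    open Descent G M
    open Block (descend-all cs xs valid conn vmin vmin∈M)
    local : ∀ u → u ∈ part → u ∈ M → D₁ u ≡ + 0 × (∀ w → w ∈ part → 0 ℕ.< adj G u w → w ∈ M)
    local u u∈ u∈M = sheltered-minimum effective u u∈M part (λ w → sheltered u w u∈ u∈M)
    part⊆M : ∀ t → t ∈ part → t ∈ M
    part⊆M t t∈ = connected-closure M (λ u w u∈ u∈M w∈ → proj₂ (local u u∈ u∈M) w w∈)
                    (proj₂ connected anchor t anchor∈part t∈) anchor∈part anchor∈M
    silent : ∀ u → finalLabel cs u ≡ finalLabel cs anchor → D₁ u ≡ + 0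
    silent u same = proj₁ (local u (class⊆part u same) (part⊆M u (class⊆part u same)))

-- Corollary 3.1.  Writing D₁ = D₀ + L f, some class of the labelling
-- produced by the cut sequence avoids the support of D₁; that class is the
-- block of Π of any of its vertices, so D₁ does not meet every block.
corollary3p1 : (n : ℕ) (G : Graph n) → Connected G →
    (k : ℕ) → 1 ≤ k → k ≤ n ∸ 1 →
    (π : Fin n → Fin (suc k)) → IsPartition G π →
    (D₀ : Divisor n) → IsBoundary G π D₀ →
    ¬ (∃[ D₁ ] (Effective D₁ × D₁ ∼⟨ G ⟩ D₀ × MeetsEveryBlock D₁ π))
corollary3p1 zero G _ k _ _ π _ D₀ _ (D₁ , _ , _ , meets) with meets zero
... | () , _
corollary3p1 (suc n) G connected k _ _ π _ D₀ (cs , (valid , yields) , xs , D₀≡)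
             (D₁ , effective , (f , D₁-D₀≡Lf) , meets) =
  let (v , silent) = AtMinimum.silent-class G cs xs valid D₁ f D₁≡ vmin f-min connected effective
      (u , πu≡πv , D₁u≢0) = meets (π v)
  in D₁u≢0 (silent u (Equivalence.from (yields u v) πu≡πv))
  where
  vmin : Fin (suc n)
  vmin = proj₁ (minimum f)
  f-min : ∀ w → f vmin ℤ.≤ f w
  f-min = proj₂ (minimum f)
  D₁≡ : ∀ u → D₁ u ≡ + boundarySum G cs xs u ℤ.+ applyL G f u
  D₁≡ u = trans (regroup (D₁ u) (D₀ u)) (cong₂ ℤ._+_ (D₀≡ u) (D₁-D₀≡Lf u))
    where
    regroup : ∀ x y → x ≡ y ℤ.+ (x ℤ.- y)
    regroup = solve-∀
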